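{- There exist $\mathrm{CFL}$-simple languages. Moreover, there exists a $\mathrm{CFL}$-simple language $L$ over an alphabet $\Sigma$ whose complement $\Sigma^*-L$ belongs to $\mathrm{CFL}(2)\cap\mathrm{REG}/n$.
   Context: $\mathrm{REG}$ and $\mathrm{CFL}$ are the families of regular and context-free languages. A language $L$ is $\mathrm{CFL}$-immune if $L$ is infinite and no infinite subset of $L$ is context-free. A language $L$ over $\Sigma$ is $\mathrm{CFL}$-simple if $L$ is infinite, $L\in\mathrm{CFL}$, and its complement $\Sigma^*-L$ is $\mathrm{CFL}$-immune. $\mathrm{CFL}(2)$ is the family of languages $L_1\cap L_2$ with $L_1,L_2\in\mathrm{CFL}$. $\mathrm{REG}/n$ is the family of languages $L$ over $\Sigma$ for which there exist an alphabet $\Gamma$, $h:\mathbb{N}\to\Gamma^*$ with $|h(n)|=n$, and a regular language $A$ over $\Sigma\times\Gamma$ such that for all $x\in\Sigma^*$: $x\in L$ iff $\left[\begin{smallmatrix}x\\ h(|x|)\end{smallmatrix}\right]\in A$, where $\left[\begin{smallmatrix}x_1\cdots x_n\\ y_1\cdots y_n\end{smallmatrix}\right]=(x_1,y_1)\cdots(x_n,y_n)$. -}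

module Defs where

open import Data.Nat using (ℕ; _≤_)
open import Data.Fin using (Fin)
open import Data.Bool using (Bool; T)
open import Data.List using (List; []; _∷_; _++_; [_]; length; zip; foldl)
open import Data.List.Membership.Propositional using (_∈_)
open import Data.Product using (Σ; ∃; ∃-syntax; _×_; _,_)
open import Data.Sum using (_⊎_; inj₁; inj₂)
open import Relation.Nullary using (¬_)
open import Relation.Binary.PropositionalEquality using (_≡_)

Language : Set → Set₁
Language A = List A → Set

Compl : {A : Set} → Language A → Language A
Compl L w = ¬ L w

_≐_ : {A : Set} → Language A → Language A → Set
L ≐ K = ∀ w → (L w → K w) × (K w → L w)

_⊆L_ : {A : Set} → Language A → Language A → Set
L ⊆L K = ∀ w → L w → K w

-- L is infinite: it contains words of arbitrarily large length
-- (over a finite alphabet this is the same as having infinitely many words).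
Infinite : {A : Set} → Language A → Set
Infinite L = ∀ (n : ℕ) → ∃[ w ] (n ≤ length w × L w)

record CFG (k m : ℕ) : Set where
  field
    start : Fin m
    rules : List (Fin m × List (Fin m ⊎ Fin k))

module _ {k m : ℕ} (G : CFG k m) where
  open CFG G
  data Gen : (Fin m ⊎ Fin k) → List (Fin k) → Set
  data GenList : List (Fin m ⊎ Fin k) → List (Fin k) → Set
  data Gen where
    term : ∀ a → Gen (inj₂ a) [ a ]
    rule : ∀ {A rhs w} → (A , rhs) ∈ rules → GenList rhs w → Gen (inj₁ A) w
  data GenList where
    nil  : GenList [] []
    cons : ∀ {s ss u v} → Gen s u → GenList ss v → GenList (s ∷ ss) (u ++ v)

LangCFG : {k m : ℕ} → CFG k m → Language (Fin k)
LangCFG G w = Gen G (inj₁ (CFG.start G)) w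

IsCFL : {k : ℕ} → Language (Fin k) → Set
IsCFL {k} L = Σ ℕ λ m → Σ (CFG k m) λ G → L ≐ LangCFG G

CFLImmune : {k : ℕ} → Language (Fin k) → Set₁
CFLImmune L = Infinite L × (∀ K → K ⊆L L → Infinite K → ¬ IsCFL K)

CFLSimple : {k : ℕ} → Language (Fin k) → Set₁
CFLSimple L = Infinite L × IsCFL L × CFLImmune (Compl L)

IsCFL2 : {k : ℕ} → Language (Fin k) → Set₁
IsCFL2 {k} L = Σ (Language (Fin k)) λ L₁ → Σ (Language (Fin k)) λ L₂ →
  IsCFL L₁ × IsCFL L₂ × (L ≐ λ w → L₁ w × L₂ w)

record DFA (A : Set) (q : ℕ) : Set where
  field
    init   : Fin q
    δ      : Fin q → A → Fin q
    accept : Fin q → Bool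

LangDFA : {A : Set} {q : ℕ} → DFA A q → Language A
LangDFA D w = T (DFA.accept D (foldl (DFA.δ D) (DFA.init D) w))

IsREG : {A : Set} → Language A → Set
IsREG {A} L = Σ ℕ λ q → Σ (DFA A q) λ D → L ≐ LangDFA D

IsREGn : {k : ℕ} → Language (Fin k) → Set₁
IsREGn {k} L = Σ ℕ λ g → Σ (ℕ → List (Fin g)) λ h →
  (∀ n → length (h n) ≡ n) ×
  (Σ (Language (Fin k × Fin g)) λ A → IsREG A ×
     (∀ x → (L x → A (zip x (h (length x)))) × (A (zip x (h (length x))) → L x)))

module Submission where

-- The language L is the complement of {aⁿbⁿcⁿ}: the words containing one of
-- the factors ba, ca, cb, together with the words aⁱbʲcᵏ with i ≢ j or j ≢ k.
-- A grammar generates it, while its complement {aⁿbⁿcⁿ} = aⁿbⁿc* ∩ a*bⁿcⁿ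
-- is in CFL(2).  That complement is CFL-immune: by the pumping lemma an
-- infinite context-free subset would contain words u v z x y and u v² z x² y
-- with vx nonempty.  As the second word is sorted, v and x are each powers of
-- a single letter, so some letter's count does not grow; yet both words are
-- of the form aⁿbⁿcⁿ, so all three counts grow by the same amount, which must
-- be zero.  Finally {aⁿbⁿcⁿ} has at most one word of each length, so with that
-- word as advice membership becomes a letter-by-letter comparison.

open import Defs
open import Data.Nat using (ℕ; zero; suc; _+_; _*_; _^_; _≤_; _<_; z≤n; s≤s; z<s; s<s; _<?_)
open import Data.Nat.Properties
open import Data.Nat.Divisibility using (_∣?_; divides)
open import Data.Fin using (Fin) renaming (_≟_ to _≟ᶠ_; _≤_ to _≤ᶠ_; _<_ to _<ᶠ_)
import Data.Fin.Properties as Finₚ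
open import Data.Bool using (Bool; true; false; T)
open import Data.Unit using (tt)
open import Data.Maybe using (Maybe; just; nothing; is-just)
open import Data.Maybe.Properties using (just-injective)
open import Data.List
  using (List; []; _∷_; _++_; length; map; lookup; replicate; filter; concatMap; allFin; zip; foldl)
open import Data.List.Properties
  using (++-assoc; ++-identityʳ; length-++; length-++-≤ˡ; length-++-≤ʳ; length-map; length-replicate;
         filter-++; filter-all; filter-none; map-injective; ∷-injective; ++-monoid)
open import Data.List.Extrema.Nat using (max; xs≤max)
open import Data.List.Membership.Propositional using (_∈_)
open import Data.List.Membership.Propositional.Properties
  using (∈-lookup; ∈-map⁺; ∈-map⁻; ∈-concatMap⁺; ∈-concatMap⁻; ∈-allFin)
open import Data.List.Relation.Unary.Any as Any using (here; there)
open import Data.List.Relation.Unary.All as All using (All; []; _∷_)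
open import Data.List.Relation.Unary.All.Properties
  using (¬Any⇒All¬; replicate⁺; ++⁻ˡ; ++⁻ʳ) renaming (++⁺ to All-++⁺)
open import Data.List.Relation.Unary.AllPairs using (AllPairs; []; _∷_)
open import Data.List.Relation.Unary.AllPairs.Properties using (++⁺)
open import Data.List.Relation.Unary.Unique.Propositional using (Unique)
open import Data.Product using (Σ; ∃-syntax; _×_; _,_; proj₁; proj₂)
open import Data.Sum using (_⊎_; inj₁; inj₂; [_,_])
open import Data.Empty using (⊥-elim)
open import Function using (id; _∘_; _$_)
open import Relation.Nullary using (¬_; yes; no)
open import Relation.Binary.Definitions using (tri<; tri≈; tri>)
open import Relation.Binary.PropositionalEquality
open import Data.Nat.Tactic.RingSolver using (solve-∀)

wrap : {A : Set} → List A → List A → List A → List A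
wrap p q w = p ++ w ++ q

wrap-wrap : {A : Set} (p₁ q₁ p₂ q₂ w : List A) →
            wrap p₂ q₂ (wrap p₁ q₁ w) ≡ wrap (p₂ ++ p₁) (q₁ ++ q₂) w
wrap-wrap p₁ q₁ p₂ q₂ w = begin
  p₂ ++ (p₁ ++ w ++ q₁) ++ q₂   ≡⟨ cong (p₂ ++_) (++-assoc p₁ (w ++ q₁) q₂) ⟩
  p₂ ++ p₁ ++ (w ++ q₁) ++ q₂   ≡⟨ cong (λ t → p₂ ++ p₁ ++ t) (++-assoc w q₁ q₂) ⟩
  p₂ ++ p₁ ++ w ++ q₁ ++ q₂     ≡⟨ ++-assoc p₂ p₁ (w ++ q₁ ++ q₂) ⟨
  (p₂ ++ p₁) ++ w ++ q₁ ++ q₂   ∎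
  where open ≡-Reasoning

replicate-∷ʳ : ∀ {X : Set} n (x : X) → replicate n x ++ x ∷ [] ≡ x ∷ replicate n x
replicate-∷ʳ zero    x = refl
replicate-∷ʳ (suc n) x = cong (x ∷_) (replicate-∷ʳ n x)

replicate-+ : ∀ {X : Set} m n (x : X) → replicate (m + n) x ≡ replicate m x ++ replicate n x
replicate-+ zero    n x = refl
replicate-+ (suc m) n x = cong (x ∷_) (replicate-+ m n x)

<⇒≡+suc : ∀ {m n} → m < n → ∃[ d ] n ≡ m + suc d
<⇒≡+suc {zero}  {suc n} _         = n , refl
<⇒≡+suc {suc m} {suc n} (s<s m<n) with d , refl ← <⇒≡+suc m<n = d , refl

0<p+q : ∀ p q {z} → z < p + (z + q) → 0 < p + q
0<p+q (suc p) q       _  = z<s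
0<p+q zero    (suc q) _  = z<s
0<p+q zero    zero {z} lt = ⊥-elim (<-irrefl (sym (+-identityʳ z)) lt)

lookup-injective : {A : Set} {xs : List A} → Unique xs →
                   ∀ {i j} → lookup xs i ≡ lookup xs j → i ≡ j
lookup-injective (_ ∷ _)   {Fin.zero}  {Fin.zero}  _  = refl
lookup-injective (x∉ ∷ _)  {Fin.zero}  {Fin.suc j} eq = ⊥-elim (All.lookup x∉ (∈-lookup j) eq)
lookup-injective (x∉ ∷ _)  {Fin.suc i} {Fin.zero}  eq = ⊥-elim (All.lookup x∉ (∈-lookup i) (sym eq))
lookup-injective (_ ∷ xs!) {Fin.suc i} {Fin.suc j} eq = cong Fin.suc (lookup-injective xs! eq)

Unique⇒length≤ : ∀ {m} {xs : List (Fin m)} → Unique xs → length xs ≤ m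
Unique⇒length≤ xs! = Finₚ.injective⇒≤ (lookup-injective xs!)

AllPairs-++⁻ : ∀ {A : Set} {R : A → A → Set} xs {ys} → AllPairs R (xs ++ ys) →
               AllPairs R xs × AllPairs R ys × All (λ x → All (R x) ys) xs
AllPairs-++⁻ []       rs       = [] , rs , []
AllPairs-++⁻ (x ∷ xs) (r ∷ rs) with rs₁ , rs₂ , cross ← AllPairs-++⁻ xs rs =
  ++⁻ˡ xs r ∷ rs₁ , rs₂ , ++⁻ʳ xs r ∷ cross

≐-trans : {A : Set} {L K M : Language A} → L ≐ K → K ≐ M → L ≐ M
≐-trans L≐K K≐M w = proj₁ (K≐M w) ∘ proj₁ (L≐K w) , proj₂ (L≐K w) ∘ proj₂ (K≐M w)

-- The pumping lemma

record Hole {A : Set} (P Q : List A → Set) : Set where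
  constructor hole
  field
    left right : List A
    fill : ∀ {w} → P w → Q (wrap left right w)

open Hole

width : {A : Set} {P Q : List A → Set} → Hole P Q → ℕ
width h = length (left h) + length (right h)

module _ {A : Set} {P Q R : List A → Set} where

  mapHole : (∀ {w} → Q w → R w) → Hole P Q → Hole P R
  mapHole g (hole p q f) = hole p q (g ∘ f)

  _⨾_ : Hole P Q → Hole Q R → Hole P R
  hole p₁ q₁ f₁ ⨾ hole p₂ q₂ f₂ =
    hole (p₂ ++ p₁) (q₁ ++ q₂) (λ {w} x → subst R (wrap-wrap p₁ q₁ p₂ q₂ w) (f₂ (f₁ x)))

  width-⨾ : (h₁ : Hole P Q) (h₂ : Hole Q R) → width h₂ ≤ width (h₁ ⨾ h₂)
  width-⨾ (hole p₁ q₁ _) (hole p₂ q₂ _) =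
    +-mono-≤ (length-++-≤ˡ p₂) (length-++-≤ʳ q₂ {q₁})

record Pumpable {A : Set} (L : Language A) : Set where
  field
    u v z x y : List A
    nonempty  : 0 < length v + length x
    once      : L (wrap u y (wrap v x z))
    twice     : L (wrap u y (wrap v x (wrap v x z)))

Pumpable-mono : {A : Set} {L K : Language A} → L ⊆L K → Pumpable L → Pumpable K
Pumpable-mono L⊆K p = record
  { u = u ; v = v ; z = z ; x = x ; y = y ; nonempty = nonempty
  ; once = L⊆K _ once ; twice = L⊆K _ twice }
  where open Pumpable p

module CFGPumping {k m : ℕ} (G : CFG k m) where
  open CFG G
  open import Data.List.Membership.DecPropositional (_≟ᶠ_ {m}) using (_∈?_)

  Symbol : Set
  Symbol = Fin m ⊎ Fin k

  size  : ∀ {s w} → Gen G s w → ℕ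
  sizes : ∀ {ss w} → GenList G ss w → ℕ
  size (term _)     = 1
  size (rule _ ds)  = suc (sizes ds)
  sizes nil         = 0
  sizes (cons d ds) = size d + sizes ds

  branching : ℕ
  branching = suc (max 0 (map (length ∘ proj₂) rules))

  rhs≤branching : ∀ {A rhs} → (A , rhs) ∈ rules → length rhs ≤ branching
  rhs≤branching rhs∈ = m≤n⇒m≤1+n (All.lookup (xs≤max 0 _) (∈-map⁺ (length ∘ proj₂) rhs∈))

  Context : Symbol → Symbol → Set
  Context s t = Hole (Gen G s) (Gen G t)

  record Loop (s : Symbol) (C : Fin m) : Set where
    constructor loop
    field
      context  : Context s (inj₁ C)
      nonempty : 0 < width context

  extend : ∀ {s s' C} → Context s' s → Loop s C → Loop s' C
  extend h (loop c ne) = loop (h ⨾ c) (<-≤-trans ne (width-⨾ h c))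

  record Child (ss : List Symbol) (w : List (Fin k)) (n : ℕ) : Set where
    field
      {symbol}  : Symbol
      {yield}   : List (Fin k)
      tree      : Gen G symbol yield
      small     : size tree ≤ n
      context   : Hole (Gen G symbol) (GenList G ss)
      split     : w ≡ wrap (left context) (right context) yield
      dominant  : length w ≤ length ss * length yield

  largestChild : ∀ {s ss w} (ds : GenList G (s ∷ ss) w) → Child (s ∷ ss) w (sizes ds)
  largestChild (cons {u = u} d nil) = record
    { tree = d ; small = m≤m+n _ 0 ; context = hole [] [] (λ d′ → cons d′ nil)
    ; split = refl ; dominant = ≤-reflexive (length-++ u) }
  largestChild {ss = s′ ∷ ss} (cons {u = u} {v = v} d ds@(cons _ _))
    with c ← largestChild ds | length u <? length (Child.yield c)
  ... | yes u<c = record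
    { tree = tree ; small = ≤-trans small (m≤n+m _ (size d))
    ; context = hole (u ++ left context) (right context)
        (λ {t} d′ → subst (GenList G _) (sym (++-assoc u _ _)) (cons d (fill context d′)))
    ; split = trans (cong (u ++_) split) (sym (++-assoc u _ _))
    ; dominant = begin
        length (u ++ v)                       ≡⟨ length-++ u ⟩
        length u + length v                   ≤⟨ +-mono-≤ (<⇒≤ u<c) dominant ⟩
        length yield + length (s′ ∷ ss) * length yield ∎ }
    where open Child c
          open ≤-Reasoning
  ... | no u≮c = record
    { tree = d ; small = m≤m+n _ _ ; context = hole [] v (λ d′ → cons d′ ds)
    ; split = refl
    ; dominant = begin
        length (u ++ v)                       ≡⟨ length-++ u ⟩
        length u + length v                   ≤⟨ +-monoʳ-≤ (length u) (≤-trans (Child.dominant c)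
                                                   (*-monoʳ-≤ (length (s′ ∷ ss)) (≮⇒≥ u≮c))) ⟩
        length u + length (s′ ∷ ss) * length u ∎ }
    where open ≤-Reasoning

  shrinking-child-has-context : ∀ {ss w n} (c : Child ss w n) →
                                length (Child.yield c) < length w → 0 < width (Child.context c)
  shrinking-child-has-context c c<w = 0<p+q (length (left context)) (length (right context))
    (<-≤-trans c<w (≤-reflexive (trans (cong length split)
      (trans (length-++ (left context)) (cong (length (left context) +_) (length-++ yield))))))
    where open Child c

  pumpingLength : ℕ
  pumpingLength = branching ^ m

  budget-step : ∀ {A rhs} → (A , rhs) ∈ rules → ∀ n {x y} → x ≤ length rhs * y →
                branching ^ n * x ≤ branching ^ suc n * y
  budget-step {rhs = rhs} rhs∈ n {x} {y} x≤rhs*y = begin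
    branching ^ n * x                  ≤⟨ *-monoʳ-≤ (branching ^ n) x≤rhs*y ⟩
    branching ^ n * (length rhs * y)   ≤⟨ *-monoʳ-≤ (branching ^ n)
                                            (*-monoˡ-≤ y (rhs≤branching rhs∈)) ⟩
    branching ^ n * (branching * y)    ≡⟨ *-assoc (branching ^ n) branching y ⟨
    branching ^ n * branching * y      ≡⟨ cong (_* y) (*-comm (branching ^ n) branching) ⟩
    branching ^ suc n * y              ∎
    where open ≤-Reasoning

  pump : ∀ {A z} → Loop (inj₁ A) A → Context (inj₁ A) (inj₁ start) → Gen G (inj₁ A) z →
         Pumpable (LangCFG G)
  pump (loop (hole v x f) v+x>0) (hole u y g) d = record
    { u = u ; v = v ; z = _ ; x = x ; y = y ; nonempty = v+x>0
    ; once = g (f d) ; twice = g (f (f d)) }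

  -- Walk down the tree, always into a longest child, recording the
  -- nonterminals at which the yield shrinks (by at most a factor `branching`).
  -- The last hypothesis keeps the yield long relative to the number of
  -- recorded nonterminals; at a leaf it would force more than m distinct ones,
  -- so some nonterminal repeats first, and that loop is pumped.
  descend : ∀ fuel {s w} (d : Gen G s w) → size d ≤ fuel →
            (cs : List (Fin m)) → Unique cs → All (Loop s) cs →
            Context s (inj₁ start) →
            pumpingLength < branching ^ length cs * length w →
            Pumpable (LangCFG G)
  descend zero (term _)   () _ _ _ _ _
  descend zero (rule _ _) () _ _ _ _ _
  descend (suc _) (term _) _ cs cs! _ _ big = ⊥-elim (<⇒≱ big (begin
    branching ^ length cs * 1 ≡⟨ *-identityʳ _ ⟩
    branching ^ length cs     ≤⟨ ^-monoʳ-≤ branching (Unique⇒length≤ cs!) ⟩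
    pumpingLength             ∎))
    where open ≤-Reasoning
  descend (suc _) (rule _ nil) _ cs _ _ _ big =
    ⊥-elim (<⇒≱ big (≤-trans (≤-reflexive (*-zeroʳ (branching ^ length cs))) z≤n))
  descend (suc fuel) {w = w} (rule {A = A} rhs∈ ds@(cons _ _)) (s≤s bound) cs cs! loops outer big
    with c ← largestChild ds | length (Child.yield c) <? length w
  ... | no c≮w =
    descend fuel tree (≤-trans small bound) cs cs! (All.map (extend h) loops) (h ⨾ outer)
      (<-≤-trans big (*-monoʳ-≤ (branching ^ length cs) (≮⇒≥ c≮w)))
    where open Child c
          h = mapHole (rule rhs∈) context
  ... | yes c<w with A ∈? cs
  ...   | yes A∈cs = pump (All.lookup loops A∈cs) outer (rule rhs∈ ds)
  ...   | no  A∉cs =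
    descend fuel tree (≤-trans small bound) (A ∷ cs) (¬Any⇒All¬ cs A∉cs ∷ cs!)
      (loop h (shrinking-child-has-context c c<w) ∷ All.map (extend h) loops) (h ⨾ outer)
      (<-≤-trans big (budget-step rhs∈ (length cs) dominant))
    where open Child c
          h = mapHole (rule rhs∈) context

  pumping : ∀ {w} → LangCFG G w → pumpingLength < length w → Pumpable (LangCFG G)
  pumping {w} d big =
    descend (size d) d ≤-refl [] [] [] root (<-≤-trans big (≤-reflexive (sym (*-identityˡ (length w)))))
    where root = hole [] [] (λ d′ → subst (Gen G _) (sym (++-identityʳ _)) d′)

infinite-CFL-pumpable : ∀ {k} {L : Language (Fin k)} → IsCFL L → Infinite L → Pumpable L
infinite-CFL-pumpable (_ , G , L≐G) ∞ =
  let w , big , Lw = ∞ (suc (CFGPumping.pumpingLength G))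
  in Pumpable-mono (λ w → proj₂ (L≐G w)) (CFGPumping.pumping G (proj₁ (L≐G w) Lw) big)

isCFL-LangCFG : ∀ {k m} (G : CFG k m) → IsCFL (LangCFG G)
isCFL-LangCFG G = _ , G , λ _ → id , id

infixr 5 _∷ᵈ_
pattern _∷ᵈ_ d ds = cons d ds

Productions : ℕ → ℕ → Set
Productions k m = Fin m → List (List (Fin m ⊎ Fin k))

rulesOf : ∀ {k m} → Productions k m → Fin m → List (Fin m × List (Fin m ⊎ Fin k))
rulesOf P A = map (A ,_) (P A)

fromProductions : ∀ {k m} → Productions k m → Fin m → CFG k m
fromProductions {m = m} P s = record { start = s ; rules = concatMap (rulesOf P) (allFin m) }

module FromProductions {k m} (P : Productions k m) (s : Fin m) where

  G : CFG k m
  G = fromProductions P s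

  ∈-rules⁺ : ∀ {A rhs} → rhs ∈ P A → (A , rhs) ∈ CFG.rules G
  ∈-rules⁺ {A} rhs∈ =
    ∈-concatMap⁺ (rulesOf P) (Any.map (λ { refl → ∈-map⁺ (A ,_) rhs∈ }) (∈-allFin A))

  ∈-rules⁻ : ∀ {A rhs} → (A , rhs) ∈ CFG.rules G → rhs ∈ P A
  ∈-rules⁻ rule∈ with _ , A,rhs∈ ← Any.satisfied (∈-concatMap⁻ (rulesOf P) {xs = allFin m} rule∈)
                 with _ , rhs∈ , refl ← ∈-map⁻ (_ ,_) A,rhs∈ = rhs∈

  derive : ∀ {A rhs w} → rhs ∈ P A → GenList G rhs w → Gen G (inj₁ A) w
  derive = rule ∘ ∈-rules⁺

  module _ {A : Fin m} {ℓ : Fin k} (P≡ : P A ≡ [] ∷ (inj₂ ℓ ∷ inj₁ A ∷ []) ∷ []) where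

    star-sound : ∀ {w} → Gen G (inj₁ A) w → ∃[ n ] w ≡ replicate n ℓ
    star-sound (rule rule∈ ds) with subst (_ ∈_) P≡ (∈-rules⁻ rule∈) | ds
    ... | here refl         | nil = 0 , refl
    ... | there (here refl) | term _ ∷ᵈ d ∷ᵈ nil with n , refl ← star-sound d =
      suc n , cong (ℓ ∷_) (++-identityʳ _)

    star-complete : ∀ n → Gen G (inj₁ A) (replicate n ℓ)
    star-complete zero    = derive (subst (_ ∈_) (sym P≡) (here refl)) nil
    star-complete (suc n) = subst (Gen G _) (cong (ℓ ∷_) (++-identityʳ _))
      (derive (subst (_ ∈_) (sym P≡) (there (here refl))) (term ℓ ∷ᵈ star-complete n ∷ᵈ nil))

  module _ {A : Fin m} {ℓ ℓ′ : Fin k}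
           (P≡ : P A ≡ [] ∷ (inj₂ ℓ ∷ inj₁ A ∷ inj₂ ℓ′ ∷ []) ∷ []) where

    private
      balanced-step : ∀ n → ℓ ∷ (replicate n ℓ ++ replicate n ℓ′) ++ ℓ′ ∷ [] ≡
                            replicate (suc n) ℓ ++ replicate (suc n) ℓ′
      balanced-step n = cong (ℓ ∷_) (trans (++-assoc (replicate n ℓ) _ _)
                                          (cong (replicate n ℓ ++_) (replicate-∷ʳ n ℓ′)))

    balanced-sound : ∀ {w} → Gen G (inj₁ A) w → ∃[ n ] w ≡ replicate n ℓ ++ replicate n ℓ′
    balanced-sound (rule rule∈ ds) with subst (_ ∈_) P≡ (∈-rules⁻ rule∈) | ds
    ... | here refl         | nil = 0 , refl
    ... | there (here refl) | term _ ∷ᵈ d ∷ᵈ term _ ∷ᵈ nil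
      with n , refl ← balanced-sound d = suc n , balanced-step n

    balanced-complete : ∀ n → Gen G (inj₁ A) (replicate n ℓ ++ replicate n ℓ′)
    balanced-complete zero    = derive (subst (_ ∈_) (sym P≡) (here refl)) nil
    balanced-complete (suc n) = subst (Gen G _) (balanced-step n)
      (derive (subst (_ ∈_) (sym P≡) (there (here refl)))
              (term ℓ ∷ᵈ balanced-complete n ∷ᵈ term ℓ′ ∷ᵈ nil))

  module _ {A : Fin m} (P≡ : P A ≡ [] ∷ map (λ ℓ → inj₂ ℓ ∷ inj₁ A ∷ []) (allFin k)) where

    universal : ∀ w → Gen G (inj₁ A) w
    universal []      = derive (subst (_ ∈_) (sym P≡) (here refl)) nil
    universal (ℓ ∷ w) = subst (Gen G _) (cong (ℓ ∷_) (++-identityʳ w))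
      (derive (subst (_ ∈_) (sym P≡) (there (∈-map⁺ _ (∈-allFin ℓ))))
              (term ℓ ∷ᵈ universal w ∷ᵈ nil))

-- The language {aⁿbⁿcⁿ} and its complement

Letter : Set
Letter = Fin 3

pattern a = Fin.zero
pattern b = Fin.suc Fin.zero
pattern c = Fin.suc (Fin.suc Fin.zero)

Word : Set
Word = List Letter

a^_b^_c^_ : ℕ → ℕ → ℕ → Word
a^ i b^ j c^ k = replicate i a ++ replicate j b ++ replicate k c

ABC : Language Letter
ABC w = ∃[ n ] w ≡ a^ n b^ n c^ n

count : Letter → Word → ℕ
count ℓ w = length (filter (_≟ᶠ ℓ) w)

count-++ : ∀ ℓ u v → count ℓ (u ++ v) ≡ count ℓ u + count ℓ v
count-++ ℓ u v = trans (cong length (filter-++ (_≟ᶠ ℓ) u v)) (length-++ (filter (_≟ᶠ ℓ) u))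

count-all : ∀ {ℓ w} → All (_≡ ℓ) w → count ℓ w ≡ length w
count-all {ℓ} = cong length ∘ filter-all (_≟ᶠ ℓ)

count-none : ∀ {ℓ w} → All (_≢ ℓ) w → count ℓ w ≡ 0
count-none {ℓ} = cong length ∘ filter-none (_≟ᶠ ℓ)

count-replicate : ∀ n ℓ → count ℓ (replicate n ℓ) ≡ n
count-replicate n ℓ = trans (count-all (replicate⁺ n refl)) (length-replicate n)

count-replicate-≢ : ∀ n {ℓ ℓ′} → ℓ′ ≢ ℓ → count ℓ (replicate n ℓ′) ≡ 0
count-replicate-≢ n ℓ′≢ℓ = count-none (replicate⁺ n ℓ′≢ℓ)

count-a^b^c^ : ∀ ℓ i j k → count ℓ (a^ i b^ j c^ k) ≡
               count ℓ (replicate i a) + (count ℓ (replicate j b) + count ℓ (replicate k c))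
count-a^b^c^ ℓ i j k =
  trans (count-++ ℓ (replicate i a) _) (cong (count ℓ (replicate i a) +_) (count-++ ℓ (replicate j b) _))

count-a : ∀ i j k → count a (a^ i b^ j c^ k) ≡ i
count-a i j k = trans (count-a^b^c^ a i j k) (trans
  (cong₂ _+_ (count-replicate i a) (cong₂ _+_ (count-replicate-≢ j λ ()) (count-replicate-≢ k λ ())))
  (+-identityʳ i))

count-b : ∀ i j k → count b (a^ i b^ j c^ k) ≡ j
count-b i j k = trans (count-a^b^c^ b i j k) (trans
  (cong₂ _+_ (count-replicate-≢ i λ ()) (cong₂ _+_ (count-replicate j b) (count-replicate-≢ k λ ())))
  (+-identityʳ j))

count-c : ∀ i j k → count c (a^ i b^ j c^ k) ≡ k
count-c i j k = trans (count-a^b^c^ c i j k)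
  (cong₂ _+_ (count-replicate-≢ i λ ()) (cong₂ _+_ (count-replicate-≢ j λ ()) (count-replicate k c)))

count-aⁿbⁿcⁿ : ∀ ℓ n → count ℓ (a^ n b^ n c^ n) ≡ n
count-aⁿbⁿcⁿ a n = count-a n n n
count-aⁿbⁿcⁿ b n = count-b n n n
count-aⁿbⁿcⁿ c n = count-c n n n

a^b^c^-injective : ∀ {i j k i′ j′ k′} → a^ i b^ j c^ k ≡ a^ i′ b^ j′ c^ k′ →
                   i ≡ i′ × j ≡ j′ × k ≡ k′
a^b^c^-injective {i} {j} {k} {i′} {j′} {k′} eq =
    trans (sym (count-a i j k)) (trans (cong (count a) eq) (count-a i′ j′ k′))
  , trans (sym (count-b i j k)) (trans (cong (count b) eq) (count-b i′ j′ k′))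
  , trans (sym (count-c i j k)) (trans (cong (count c) eq) (count-c i′ j′ k′))

Sorted : Word → Set
Sorted = AllPairs _≤ᶠ_

replicate-sorted : ∀ n ℓ → Sorted (replicate n ℓ)
replicate-sorted zero    ℓ = []
replicate-sorted (suc n) ℓ = replicate⁺ n Finₚ.≤-refl ∷ replicate-sorted n ℓ

a^b^c^-sorted : ∀ i j k → Sorted (a^ i b^ j c^ k)
a^b^c^-sorted i j k =
  ++⁺ (replicate-sorted i a)
      (++⁺ (replicate-sorted j b) (replicate-sorted k c) (replicate⁺ j (replicate⁺ k (s≤s z≤n))))
      (replicate⁺ i (All-++⁺ (replicate⁺ j z≤n) (replicate⁺ k z≤n)))

all≤all⇒constant : ∀ {v : Word} → All (λ x → All (x ≤ᶠ_) v) v → ∃[ ℓ ] All (_≡ ℓ) v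
all≤all⇒constant {[]}    _ = a , []
all≤all⇒constant {e ∷ v} ((_ ∷ e≤v) ∷ v≤ev) =
  e , refl ∷ All.zipWith (λ (e≤y , y≤ev) → Finₚ.≤-antisym (All.head y≤ev) e≤y) (e≤v , v≤ev)

data Descent : Word → Set where
  descent : ∀ p {ℓ₁ ℓ₂} q → ℓ₂ <ᶠ ℓ₁ → Descent (p ++ ℓ₁ ∷ ℓ₂ ∷ q)

sorted⇒¬Descent : ∀ {w} → Sorted w → ¬ Descent w
sorted⇒¬Descent s (descent p q ℓ₂<ℓ₁) with _ , (ℓ₁≤ℓ₂ ∷ _) ∷ _ , _ ← AllPairs-++⁻ p s =
  <⇒≱ ℓ₂<ℓ₁ ℓ₁≤ℓ₂

third : (ℓ₁ ℓ₂ : Letter) → ∃[ ℓ ] ℓ ≢ ℓ₁ × ℓ ≢ ℓ₂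
third a                     a                     = b , (λ ()) , (λ ())
third a                     b                     = c , (λ ()) , (λ ())
third a                     (Fin.suc (Fin.suc _)) = b , (λ ()) , (λ ())
third b                     a                     = c , (λ ()) , (λ ())
third (Fin.suc (Fin.suc _)) a                     = b , (λ ()) , (λ ())
third (Fin.suc _)           (Fin.suc _)           = a , (λ ()) , (λ ())

count-wrap : ∀ ℓ p q w → count ℓ (wrap p q w) ≡ count ℓ p + (count ℓ w + count ℓ q)
count-wrap ℓ p q w = trans (count-++ ℓ p (w ++ q)) (cong (count ℓ p +_) (count-++ ℓ w q))

count-pumped : ∀ ℓ u v z x y → count ℓ (wrap u y (wrap v x (wrap v x z))) ≡
               count ℓ (wrap u y (wrap v x z)) + (count ℓ v + count ℓ x)
count-pumped ℓ u v z x y = begin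
  count ℓ (wrap u y (wrap v x (wrap v x z)))   ≡⟨ count-wrap ℓ u y _ ⟩
  #u + (count ℓ (wrap v x (wrap v x z)) + #y)  ≡⟨ cong (λ t → #u + (t + #y)) (count-wrap ℓ v x _) ⟩
  #u + ((#v + (#w + #x)) + #y)                 ≡⟨ rearrange #u #v #w #x #y ⟩
  (#u + (#w + #y)) + (#v + #x)                 ≡⟨ cong (_+ (#v + #x)) (count-wrap ℓ u y _) ⟨
  count ℓ (wrap u y (wrap v x z)) + (#v + #x)  ∎
  where
  open ≡-Reasoning
  #u = count ℓ u
  #v = count ℓ v
  #w = count ℓ (wrap v x z)
  #x = count ℓ x
  #y = count ℓ y
  rearrange : ∀ u v w x y → u + ((v + (w + x)) + y) ≡ (u + (w + y)) + (v + x)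
  rearrange = solve-∀

ABC-pumping-gain-uniform : ∀ u v z x y →
  ABC (wrap u y (wrap v x z)) → ABC (wrap u y (wrap v x (wrap v x z))) →
  ∀ ℓ ℓ′ → count ℓ v + count ℓ x ≡ count ℓ′ v + count ℓ′ x
ABC-pumping-gain-uniform u v z x y (n₁ , once) (n₂ , twice) ℓ ℓ′ =
  +-cancelˡ-≡ n₁ _ _ (trans (n₁+gain ℓ) (sym (n₁+gain ℓ′)))
  where
  n₁+gain : ∀ ℓ → n₁ + (count ℓ v + count ℓ x) ≡ n₂
  n₁+gain ℓ = begin
    n₁ + (count ℓ v + count ℓ x)
      ≡⟨ cong (_+ _) (trans (cong (count ℓ) once) (count-aⁿbⁿcⁿ ℓ n₁)) ⟨
    count ℓ (wrap u y (wrap v x z)) + (count ℓ v + count ℓ x)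
      ≡⟨ count-pumped ℓ u v z x y ⟨
    count ℓ (wrap u y (wrap v x (wrap v x z)))
      ≡⟨ trans (cong (count ℓ) twice) (count-aⁿbⁿcⁿ ℓ n₂) ⟩
    n₂ ∎
    where open ≡-Reasoning

sorted-pumped⇒constant : ∀ v z x → Sorted (wrap v x (wrap v x z)) →
                         (∃[ ℓ ] All (_≡ ℓ) v) × (∃[ ℓ ] All (_≡ ℓ) x)
sorted-pumped⇒constant v z x sorted =
  let _ , sorted′ , v≤ = AllPairs-++⁻ v sorted
      _ , _ , ≤x       = AllPairs-++⁻ (wrap v x z) sorted′
  in all≤all⇒constant (All.map (++⁻ˡ v ∘ ++⁻ˡ (wrap v x z)) v≤) ,
     all≤all⇒constant (++⁻ʳ z (++⁻ʳ v ≤x))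

ABC-unpumpable : ¬ Pumpable ABC
ABC-unpumpable record { u = u ; v = v ; z = z ; x = x ; y = y ; nonempty = v+x>0
                      ; once = once ; twice = twice@(n₂ , twice≡) } =
  <⇒≱ v+x>0 (begin
    length v + length x       ≡⟨ cong₂ _+_ (count-all v≡ℓᵥ) (count-all x≡ℓₓ) ⟨
    count ℓᵥ v + count ℓₓ x   ≤⟨ +-mono-≤ (m≤m+n (count ℓᵥ v) (count ℓᵥ x))
                                          (m≤n+m (count ℓₓ x) (count ℓₓ v)) ⟩
    gain ℓᵥ + gain ℓₓ         ≡⟨ cong₂ _+_ (uniform ℓᵥ t) (uniform ℓₓ t) ⟩
    gain t + gain t           ≡⟨ cong₂ _+_ gain-t≡0 gain-t≡0 ⟩
    0                         ∎)
  where
  open ≤-Reasoning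
  gain : Letter → ℕ
  gain ℓ = count ℓ v + count ℓ x

  uniform : ∀ ℓ ℓ′ → gain ℓ ≡ gain ℓ′
  uniform = ABC-pumping-gain-uniform u v z x y once twice

  constant = sorted-pumped⇒constant v z x
    (proj₁ (AllPairs-++⁻ (wrap v x (wrap v x z))
      (proj₁ (proj₂ (AllPairs-++⁻ u (subst Sorted (sym twice≡) (a^b^c^-sorted n₂ n₂ n₂)))))))
  ℓᵥ = proj₁ (proj₁ constant)
  v≡ℓᵥ = proj₂ (proj₁ constant)
  ℓₓ = proj₁ (proj₂ constant)
  x≡ℓₓ = proj₂ (proj₂ constant)
  t = proj₁ (third ℓᵥ ℓₓ)

  gain-t≡0 : gain t ≡ 0
  gain-t≡0 = cong₂ _+_
    (count-none (All.map (λ { refl → proj₁ (proj₂ (third ℓᵥ ℓₓ)) ∘ sym }) v≡ℓᵥ))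
    (count-none (All.map (λ { refl → proj₂ (proj₂ (third ℓᵥ ℓₓ)) ∘ sym }) x≡ℓₓ))

Unbalanced : Word → Set
Unbalanced w = ∃[ i ] ∃[ j ] ∃[ k ] (i ≢ j ⊎ j ≢ k) × w ≡ a^ i b^ j c^ k

NonABC : Language Letter
NonABC w = Descent w ⊎ Unbalanced w

a*b*c* : Word → Set
a*b*c* w = ∃[ i ] ∃[ j ] ∃[ k ] w ≡ a^ i b^ j c^ k

descent-or-a^b^c^ : ∀ w → Descent w ⊎ a*b*c* w
descent-or-a^b^c^ []      = inj₂ (0 , 0 , 0 , refl)
descent-or-a^b^c^ (ℓ ∷ w) with descent-or-a^b^c^ w
... | inj₁ (descent p q ℓ₂<ℓ₁) = inj₁ (descent (ℓ ∷ p) q ℓ₂<ℓ₁)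
... | inj₂ (i , j , k , refl)  = prepend ℓ i j k
  where
  prepend : ∀ ℓ i j k → Descent (ℓ ∷ a^ i b^ j c^ k) ⊎ a*b*c* (ℓ ∷ a^ i b^ j c^ k)
  prepend a i       j       k = inj₂ (suc i , j , k , refl)
  prepend b zero    j       k = inj₂ (0 , suc j , k , refl)
  prepend b (suc i) j       k = inj₁ (descent [] _ z<s)
  prepend c (suc i) j       k = inj₁ (descent [] _ z<s)
  prepend c zero    (suc j) k = inj₁ (descent [] _ (s<s z<s))
  prepend c zero    zero    k = inj₂ (0 , 0 , suc k , refl)

ABC-or-NonABC : ∀ w → ABC w ⊎ NonABC w
ABC-or-NonABC w with descent-or-a^b^c^ w
... | inj₁ d = inj₂ (inj₁ d)
... | inj₂ (i , j , k , eq) with i ≟ j | j ≟ k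
...   | yes refl | yes refl = inj₁ (i , eq)
...   | no i≢j   | _        = inj₂ (inj₂ (i , j , k , inj₁ i≢j , eq))
...   | yes _    | no j≢k   = inj₂ (inj₂ (i , j , k , inj₂ j≢k , eq))

ABC∩NonABC : ∀ {w} → ABC w → ¬ NonABC w
ABC∩NonABC (n , refl) (inj₁ d) = sorted⇒¬Descent (a^b^c^-sorted n n n) d
ABC∩NonABC (n , refl) (inj₂ (i , j , k , unequal , eq))
  with refl , refl , refl ← a^b^c^-injective {n} {n} {n} {i} {j} {k} eq = [ _$ refl , _$ refl ] unequal

-- A grammar for the complement

pattern S    = Fin.zero
pattern S₁   = Fin.suc S
pattern S₂   = Fin.suc S₁
pattern Σ*   = Fin.suc S₂
pattern A*   = Fin.suc Σ*
pattern B*   = Fin.suc A*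
pattern C*   = Fin.suc B*
pattern AⁿBⁿ = Fin.suc C*
pattern BⁿCⁿ = Fin.suc AⁿBⁿ

Nonterminal : Set
Nonterminal = Fin 9

nt : Nonterminal → Nonterminal ⊎ Letter
nt = inj₁

tm : Letter → Nonterminal ⊎ Letter
tm = inj₂

-- S generates NonABC: a descent ba, ca or cb, or aⁱbʲcᵏ with i > j, j > i,
-- j > k or k > j; S₁ generates aⁿbⁿcᵏ and S₂ generates aⁱbⁿcⁿ.
productions : Productions 3 9
productions S    = (nt Σ* ∷ tm b ∷ tm a ∷ nt Σ* ∷ [])
                 ∷ (nt Σ* ∷ tm c ∷ tm a ∷ nt Σ* ∷ [])
                 ∷ (nt Σ* ∷ tm c ∷ tm b ∷ nt Σ* ∷ [])
                 ∷ (tm a ∷ nt A* ∷ nt AⁿBⁿ ∷ nt C* ∷ [])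
                 ∷ (nt AⁿBⁿ ∷ tm b ∷ nt B* ∷ nt C* ∷ [])
                 ∷ (nt A* ∷ tm b ∷ nt B* ∷ nt BⁿCⁿ ∷ [])
                 ∷ (nt A* ∷ nt BⁿCⁿ ∷ tm c ∷ nt C* ∷ [])
                 ∷ []
productions S₁   = (nt AⁿBⁿ ∷ nt C* ∷ []) ∷ []
productions S₂   = (nt A* ∷ nt BⁿCⁿ ∷ []) ∷ []
productions Σ*   = [] ∷ map (λ ℓ → tm ℓ ∷ nt Σ* ∷ []) (allFin 3)
productions A*   = [] ∷ (tm a ∷ nt A* ∷ []) ∷ []
productions B*   = [] ∷ (tm b ∷ nt B* ∷ []) ∷ []
productions C*   = [] ∷ (tm c ∷ nt C* ∷ []) ∷ []
productions AⁿBⁿ = [] ∷ (tm a ∷ nt AⁿBⁿ ∷ tm b ∷ []) ∷ []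
productions BⁿCⁿ = [] ∷ (tm b ∷ nt BⁿCⁿ ∷ tm c ∷ []) ∷ []

-- The yields of the productions of S, S₁ and S₂, spelt as derivations
-- produce them (each right-hand side ends in `++ []`).
module _ where
  open ≡-Reasoning
  open import Algebra.Solver.Monoid (++-monoid Letter) using (solve; _⊜_; _⊕_) renaming (id to ε)

  yield-a>b : ∀ d j k → a ∷ replicate d a ++ (replicate j a ++ replicate j b) ++ replicate k c ++ [] ≡
                        a^ (suc d + j) b^ j c^ k
  yield-a>b d j k = begin
    a ∷ replicate d a ++ (replicate j a ++ replicate j b) ++ replicate k c ++ []
      ≡⟨ solve 5 (λ x D J B C → x ⊕ D ⊕ (J ⊕ B) ⊕ C ⊕ ε ⊜ (x ⊕ D ⊕ J) ⊕ B ⊕ C) refl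
               (a ∷ []) (replicate d a) (replicate j a) (replicate j b) (replicate k c) ⟩
    (a ∷ replicate d a ++ replicate j a) ++ replicate j b ++ replicate k c
      ≡⟨ cong (λ t → a ∷ t ++ _) (replicate-+ d j a) ⟨
    a^ (suc d + j) b^ j c^ k ∎

  yield-b>a : ∀ i d k → (replicate i a ++ replicate i b) ++ b ∷ replicate d b ++ replicate k c ++ [] ≡
                        a^ i b^ (i + suc d) c^ k
  yield-b>a i d k = begin
    (replicate i a ++ replicate i b) ++ b ∷ replicate d b ++ replicate k c ++ []
      ≡⟨ solve 5 (λ A I x D C → (A ⊕ I) ⊕ x ⊕ D ⊕ C ⊕ ε ⊜ A ⊕ (I ⊕ x ⊕ D) ⊕ C) refl
               (replicate i a) (replicate i b) (b ∷ []) (replicate d b) (replicate k c) ⟩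
    replicate i a ++ (replicate i b ++ b ∷ replicate d b) ++ replicate k c
      ≡⟨ cong (λ t → replicate i a ++ t ++ _) (replicate-+ i (suc d) b) ⟨
    a^ i b^ (i + suc d) c^ k ∎

  yield-b>c : ∀ i d k → replicate i a ++ b ∷ replicate d b ++ (replicate k b ++ replicate k c) ++ [] ≡
                        a^ i b^ (suc d + k) c^ k
  yield-b>c i d k = begin
    replicate i a ++ b ∷ replicate d b ++ (replicate k b ++ replicate k c) ++ []
      ≡⟨ solve 5 (λ A x D K C → A ⊕ x ⊕ D ⊕ (K ⊕ C) ⊕ ε ⊜ A ⊕ (x ⊕ D ⊕ K) ⊕ C) refl
               (replicate i a) (b ∷ []) (replicate d b) (replicate k b) (replicate k c) ⟩
    replicate i a ++ (b ∷ replicate d b ++ replicate k b) ++ replicate k c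
      ≡⟨ cong (λ t → replicate i a ++ b ∷ t ++ _) (replicate-+ d k b) ⟨
    a^ i b^ (suc d + k) c^ k ∎

  yield-c>b : ∀ i j d → replicate i a ++ (replicate j b ++ replicate j c) ++ c ∷ replicate d c ++ [] ≡
                        a^ i b^ j c^ (j + suc d)
  yield-c>b i j d = begin
    replicate i a ++ (replicate j b ++ replicate j c) ++ c ∷ replicate d c ++ []
      ≡⟨ solve 5 (λ A B J x D → A ⊕ (B ⊕ J) ⊕ x ⊕ D ⊕ ε ⊜ A ⊕ B ⊕ J ⊕ x ⊕ D) refl
               (replicate i a) (replicate j b) (replicate j c) (c ∷ []) (replicate d c) ⟩
    replicate i a ++ replicate j b ++ replicate j c ++ c ∷ replicate d c
      ≡⟨ cong (λ t → replicate i a ++ replicate j b ++ t) (replicate-+ j (suc d) c) ⟨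
    a^ i b^ j c^ (j + suc d) ∎

  yield-S₁ : ∀ n k → (replicate n a ++ replicate n b) ++ replicate k c ++ [] ≡ a^ n b^ n c^ k
  yield-S₁ n k = solve 3 (λ A B C → (A ⊕ B) ⊕ C ⊕ ε ⊜ A ⊕ B ⊕ C) refl
                   (replicate n a) (replicate n b) (replicate k c)

  yield-S₂ : ∀ i n → replicate i a ++ (replicate n b ++ replicate n c) ++ [] ≡ a^ i b^ n c^ n
  yield-S₂ i n = cong (replicate i a ++_) (++-identityʳ _)

module _ {s : Nonterminal} where
  open FromProductions productions s

  private
    Descending : Letter → Letter → List (Nonterminal ⊎ Letter)
    Descending ℓ₁ ℓ₂ = nt Σ* ∷ tm ℓ₁ ∷ tm ℓ₂ ∷ nt Σ* ∷ []

    descent-sound : ∀ {ℓ₁ ℓ₂ w} → ℓ₂ <ᶠ ℓ₁ → GenList G (Descending ℓ₁ ℓ₂) w → Descent w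
    descent-sound ℓ₂<ℓ₁ (cons {u = p} _ (term _ ∷ᵈ term _ ∷ᵈ cons {u = q} _ nil)) =
      descent p (q ++ []) ℓ₂<ℓ₁

    descent-complete : ∀ {ℓ₁ ℓ₂} → Descending ℓ₁ ℓ₂ ∈ productions S →
                       ∀ p q → Gen G (nt S) (p ++ ℓ₁ ∷ ℓ₂ ∷ q)
    descent-complete {ℓ₁} {ℓ₂} rhs∈ p q =
      subst (Gen G (nt S)) (cong (λ t → p ++ ℓ₁ ∷ ℓ₂ ∷ t) (++-identityʳ q))
        (derive rhs∈ (universal refl p ∷ᵈ term ℓ₁ ∷ᵈ term ℓ₂ ∷ᵈ universal refl q ∷ᵈ nil))

  S-sound : ∀ {w} → Gen G (nt S) w → NonABC w
  S-sound (rule rule∈ ds) with ∈-rules⁻ rule∈ | ds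
  ... | here refl                         | ds′ = inj₁ (descent-sound z<s ds′)
  ... | there (here refl)                 | ds′ = inj₁ (descent-sound z<s ds′)
  ... | there (there (here refl))         | ds′ = inj₁ (descent-sound (s<s z<s) ds′)
  ... | there (there (there (here refl))) | term _ ∷ᵈ dᵃ ∷ᵈ dᵃᵇ ∷ᵈ dᶜ ∷ᵈ nil
    with d , refl ← star-sound {A*} refl dᵃ | j , refl ← balanced-sound {AⁿBⁿ} refl dᵃᵇ
       | k , refl ← star-sound {C*} refl dᶜ =
    inj₂ (suc d + j , j , k , inj₁ (≢-sym (m≢1+n+m j)) , yield-a>b d j k)
  S-sound (rule rule∈ ds) | there (there (there (there (here refl))))
                          | dᵃᵇ ∷ᵈ term _ ∷ᵈ dᵇ ∷ᵈ dᶜ ∷ᵈ nil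
    with i , refl ← balanced-sound {AⁿBⁿ} refl dᵃᵇ | d , refl ← star-sound {B*} refl dᵇ
       | k , refl ← star-sound {C*} refl dᶜ =
    inj₂ (i , i + suc d , k , inj₁ (≢-sym (m+1+n≢m i)) , yield-b>a i d k)
  S-sound (rule rule∈ ds) | there (there (there (there (there (here refl)))))
                          | dᵃ ∷ᵈ term _ ∷ᵈ dᵇ ∷ᵈ dᵇᶜ ∷ᵈ nil
    with i , refl ← star-sound {A*} refl dᵃ | d , refl ← star-sound {B*} refl dᵇ
       | k , refl ← balanced-sound {BⁿCⁿ} refl dᵇᶜ =
    inj₂ (i , suc d + k , k , inj₂ (≢-sym (m≢1+n+m k)) , yield-b>c i d k)
  S-sound (rule rule∈ ds) | there (there (there (there (there (there (here refl))))))
                          | dᵃ ∷ᵈ dᵇᶜ ∷ᵈ term _ ∷ᵈ dᶜ ∷ᵈ nil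
    with i , refl ← star-sound {A*} refl dᵃ | j , refl ← balanced-sound {BⁿCⁿ} refl dᵇᶜ
       | d , refl ← star-sound {C*} refl dᶜ =
    inj₂ (i , j , j + suc d , inj₂ (≢-sym (m+1+n≢m j)) , yield-c>b i j d)

  S-complete-i≢j : ∀ i j k → i ≢ j → Gen G (nt S) (a^ i b^ j c^ k)
  S-complete-i≢j i j k i≢j with <-cmp i j
  ... | tri≈ _ i≡j _ = ⊥-elim (i≢j i≡j)
  ... | tri< i<j _ _ with d , refl ← <⇒≡+suc i<j =
    subst (Gen G (nt S)) (yield-b>a i d k)
      (derive (there (there (there (there (here refl)))))
        (balanced-complete refl i ∷ᵈ term b ∷ᵈ star-complete refl d ∷ᵈ star-complete refl k ∷ᵈ nil))
  ... | tri> _ _ j<i with d , refl ← <⇒≡+suc j<i =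
    subst (Gen G (nt S)) (trans (yield-a>b d j k) (cong (λ t → a^ t b^ j c^ k) (+-comm (suc d) j)))
      (derive (there (there (there (here refl))))
        (term a ∷ᵈ star-complete refl d ∷ᵈ balanced-complete refl j ∷ᵈ star-complete refl k ∷ᵈ nil))

  S-complete-j≢k : ∀ i j k → j ≢ k → Gen G (nt S) (a^ i b^ j c^ k)
  S-complete-j≢k i j k j≢k with <-cmp j k
  ... | tri≈ _ j≡k _ = ⊥-elim (j≢k j≡k)
  ... | tri< j<k _ _ with d , refl ← <⇒≡+suc j<k =
    subst (Gen G (nt S)) (yield-c>b i j d)
      (derive (there (there (there (there (there (there (here refl)))))))
        (star-complete refl i ∷ᵈ balanced-complete refl j ∷ᵈ term c ∷ᵈ star-complete refl d ∷ᵈ nil))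
  ... | tri> _ _ k<j with d , refl ← <⇒≡+suc k<j =
    subst (Gen G (nt S)) (trans (yield-b>c i d k) (cong (λ t → a^ i b^ t c^ k) (+-comm (suc d) k)))
      (derive (there (there (there (there (there (here refl))))))
        (star-complete refl i ∷ᵈ term b ∷ᵈ star-complete refl d ∷ᵈ balanced-complete refl k ∷ᵈ nil))

  S-complete : ∀ {w} → NonABC w → Gen G (nt S) w
  S-complete (inj₁ (descent p {b} {a} q _))     = descent-complete (here refl) p q
  S-complete (inj₁ (descent p {c} {a} q _))     = descent-complete (there (here refl)) p q
  S-complete (inj₁ (descent p {c} {b} q _))     = descent-complete (there (there (here refl))) p q
  S-complete (inj₁ (descent p {a} q ()))
  S-complete (inj₁ (descent p {b} {b} q (s<s ())))
  S-complete (inj₁ (descent p {b} {c} q (s<s ())))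
  S-complete (inj₁ (descent p {c} {c} q (s<s (s<s ()))))
  S-complete (inj₂ (i , j , k , inj₁ i≢j , refl)) = S-complete-i≢j i j k i≢j
  S-complete (inj₂ (i , j , k , inj₂ j≢k , refl)) = S-complete-j≢k i j k j≢k

  S₁-sound : ∀ {w} → Gen G (nt S₁) w → ∃[ n ] ∃[ k ] w ≡ a^ n b^ n c^ k
  S₁-sound (rule rule∈ ds) with ∈-rules⁻ rule∈ | ds
  ... | here refl | dᵃᵇ ∷ᵈ dᶜ ∷ᵈ nil
    with n , refl ← balanced-sound {AⁿBⁿ} refl dᵃᵇ | k , refl ← star-sound {C*} refl dᶜ =
    n , k , yield-S₁ n k

  S₁-complete : ∀ n k → Gen G (nt S₁) (a^ n b^ n c^ k)
  S₁-complete n k = subst (Gen G (nt S₁)) (yield-S₁ n k)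
    (derive (here refl) (balanced-complete refl n ∷ᵈ star-complete refl k ∷ᵈ nil))

  S₂-sound : ∀ {w} → Gen G (nt S₂) w → ∃[ i ] ∃[ n ] w ≡ a^ i b^ n c^ n
  S₂-sound (rule rule∈ ds) with ∈-rules⁻ rule∈ | ds
  ... | here refl | dᵃ ∷ᵈ dᵇᶜ ∷ᵈ nil
    with i , refl ← star-sound {A*} refl dᵃ | n , refl ← balanced-sound {BⁿCⁿ} refl dᵇᶜ =
    i , n , yield-S₂ i n

  S₂-complete : ∀ i n → Gen G (nt S₂) (a^ i b^ n c^ n)
  S₂-complete i n = subst (Gen G (nt S₂)) (yield-S₂ i n)
    (derive (here refl) (star-complete refl i ∷ᵈ balanced-complete refl n ∷ᵈ nil))

-- Languages with at most one word of each length are in REG/n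

module ThinREGn {k : ℕ} (word : ℕ → Maybe (List (Fin k)))
                (word-length : ∀ n {w} → word n ≡ just w → length w ≡ n) where

  -- Advice letter suc ℓ stands for ℓ, and zero marks a length without a word.
  advice : ℕ → List (Fin (suc k))
  advice n with word n
  ... | just w  = map Fin.suc w
  ... | nothing = replicate n Fin.zero

  advice-length : ∀ n → length (advice n) ≡ n
  advice-length n with word n in eq
  ... | just w  = trans (length-map Fin.suc w) (word-length n eq)
  ... | nothing = length-replicate n

  pattern fresh = Fin.zero
  pattern live  = Fin.suc Fin.zero
  pattern dead  = Fin.suc (Fin.suc Fin.zero)

  match : Fin k × Fin (suc k) → Fin 3
  match (ℓ , g) with g ≟ᶠ Fin.suc ℓ
  ... | yes _ = live
  ... | no _  = dead

  step : Fin 3 → Fin k × Fin (suc k) → Fin 3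
  step dead _ = dead
  step _    p = match p

  -- The advice for length 0 is empty, so the start state alone must decide
  -- the empty word; otherwise `fresh` behaves like `live`.
  accept : Fin 3 → Bool
  accept fresh = is-just (word 0)
  accept live  = true
  accept dead  = false

  checker : DFA (Fin k × Fin (suc k)) 3
  checker = record { init = fresh ; δ = step ; accept = accept }

  dead-absorbing : ∀ ps → foldl step dead ps ≡ dead
  dead-absorbing []       = refl
  dead-absorbing (_ ∷ ps) = dead-absorbing ps

  live-accepts-own : ∀ x → T (accept (foldl step live (zip x (map Fin.suc x))))
  live-accepts-own []      = tt
  live-accepts-own (ℓ ∷ x) with Fin.suc ℓ ≟ᶠ Fin.suc ℓ
  ... | yes _   = live-accepts-own x
  ... | no ℓ≢ℓ = ⊥-elim (ℓ≢ℓ refl)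

  live-accepts⇒own : ∀ x gs → length x ≡ length gs → T (accept (foldl step live (zip x gs))) →
                     map Fin.suc x ≡ gs
  live-accepts⇒own []      []       _  _   = refl
  live-accepts⇒own (ℓ ∷ x) (g ∷ gs) eq acc with g ≟ᶠ Fin.suc ℓ
  ... | yes refl = cong (Fin.suc ℓ ∷_) (live-accepts⇒own x gs (suc-injective eq) acc)
  ... | no _     = ⊥-elim (subst (T ∘ accept) (dead-absorbing (zip x gs)) acc)

  accepts⁺ : ∀ x → word (length x) ≡ just x → LangDFA checker (zip x (advice (length x)))
  accepts⁺ []      eq rewrite eq = tt
  accepts⁺ (ℓ ∷ x) eq rewrite eq = live-accepts-own (ℓ ∷ x)

  accepts⁻ : ∀ x → LangDFA checker (zip x (advice (length x))) → word (length x) ≡ just x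
  accepts⁻ [] acc with word 0 in eq
  ... | just []      = refl
  ... | just (_ ∷ _) = ⊥-elim (0≢1+n (sym (word-length 0 eq)))
  ... | nothing      = ⊥-elim acc
  accepts⁻ (ℓ ∷ x) acc with word (suc (length x)) in eq
  ... | just []      = ⊥-elim (0≢1+n (word-length _ eq))
  ... | just (g ∷ w) = cong just (sym (map-injective Finₚ.suc-injective
                         (live-accepts⇒own (ℓ ∷ x) (map Fin.suc (g ∷ w)) lengths acc)))
    where lengths = sym (trans (length-map Fin.suc (g ∷ w)) (word-length _ eq))
  ... | nothing      = ⊥-elim (Finₚ.0≢1+n (sym (proj₁ (∷-injective
                         (live-accepts⇒own (ℓ ∷ x) _ (sym (length-replicate (suc (length x)))) acc)))))

thin⇒REGn : ∀ {k} {L : Language (Fin k)} (word : ℕ → Maybe (List (Fin k))) →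
            (∀ n {w} → word n ≡ just w → length w ≡ n) →
            L ≐ (λ x → word (length x) ≡ just x) →
            IsREGn L
thin⇒REGn word word-length L⇔word =
  _ , advice , advice-length , LangDFA checker , (3 , checker , λ _ → id , id) ,
  λ x → accepts⁺ x ∘ proj₁ (L⇔word x) , proj₂ (L⇔word x) ∘ accepts⁻ x
  where open ThinREGn word word-length

length-a^b^c^ : ∀ i j k → length (a^ i b^ j c^ k) ≡ i + (j + k)
length-a^b^c^ i j k = trans (length-++ (replicate i a)) (cong₂ _+_ (length-replicate i)
  (trans (length-++ (replicate j b)) (cong₂ _+_ (length-replicate j) (length-replicate k))))

length-aⁿbⁿcⁿ : ∀ n → length (a^ n b^ n c^ n) ≡ n * 3
length-aⁿbⁿcⁿ n = trans (length-a^b^c^ n n n) (solve n)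
  where
  solve : ∀ n → n + (n + n) ≡ n * 3
  solve = solve-∀

aⁿbⁿcⁿ-ofLength : ℕ → Maybe Word
aⁿbⁿcⁿ-ofLength l with 3 ∣? l
... | yes (divides n _) = just (a^ n b^ n c^ n)
... | no _              = nothing

aⁿbⁿcⁿ-ofLength-length : ∀ l {w} → aⁿbⁿcⁿ-ofLength l ≡ just w → length w ≡ l
aⁿbⁿcⁿ-ofLength-length l eq with 3 ∣? l
aⁿbⁿcⁿ-ofLength-length l refl | yes (divides n l≡n*3) = trans (length-aⁿbⁿcⁿ n) (sym l≡n*3)

ABC≐ofLength : ABC ≐ λ x → aⁿbⁿcⁿ-ofLength (length x) ≡ just x
ABC≐ofLength x = to , from
  where
  to : ABC x → aⁿbⁿcⁿ-ofLength (length x) ≡ just x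
  to (n , refl) with 3 ∣? length (a^ n b^ n c^ n)
  ... | yes (divides q eq) =
    cong (λ m → just (a^ m b^ m c^ m)) (*-cancelʳ-≡ q n 3 (trans (sym eq) (length-aⁿbⁿcⁿ n)))
  ... | no 3∤ = ⊥-elim (3∤ (divides n (length-aⁿbⁿcⁿ n)))
  from : aⁿbⁿcⁿ-ofLength (length x) ≡ just x → ABC x
  from eq with 3 ∣? length x
  from eq | yes (divides n _) = n , sym (just-injective eq)

L L₁ L₂ : Language Letter
L  = LangCFG (fromProductions productions S)
L₁ = LangCFG (fromProductions productions S₁)
L₂ = LangCFG (fromProductions productions S₂)

Compl-L≐ABC : Compl L ≐ ABC
Compl-L≐ABC w = to , from
  where
  to : Compl L w → ABC w
  to ¬Lw with ABC-or-NonABC w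
  ... | inj₁ abc    = abc
  ... | inj₂ nonabc = ⊥-elim (¬Lw (S-complete nonabc))
  from : ABC w → Compl L w
  from abc Lw = ABC∩NonABC abc (S-sound Lw)

ABC≐L₁∩L₂ : ABC ≐ λ w → L₁ w × L₂ w
ABC≐L₁∩L₂ w = to , from
  where
  to : ABC w → L₁ w × L₂ w
  to (n , refl) = S₁-complete n n , S₂-complete n n
  from : L₁ w × L₂ w → ABC w
  from (w₁ , w₂) with n , k , refl ← S₁-sound w₁ | i , n′ , eq ← S₂-sound w₂
    with refl , refl , refl ← a^b^c^-injective {n} {n} {k} {i} {n′} {n′} eq = n , refl

L-infinite : Infinite L
L-infinite n = a^ suc n b^ 0 c^ 0
  , subst (n ≤_) (sym (length-a^b^c^ (suc n) 0 0)) (≤-trans (n≤1+n n) (m≤m+n (suc n) 0))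
  , S-complete (inj₂ (suc n , 0 , 0 , inj₁ (λ ()) , refl))

ABC-infinite : Infinite ABC
ABC-infinite n = a^ n b^ n c^ n , subst (n ≤_) (sym (length-a^b^c^ n n n)) (m≤m+n n (n + n)) , n , refl

Compl-L-immune : CFLImmune (Compl L)
Compl-L-immune = compl-infinite , no-infinite-CFL-subset
  where
  compl-infinite : Infinite (Compl L)
  compl-infinite n = let w , n≤w , abc = ABC-infinite n in w , n≤w , proj₂ (Compl-L≐ABC w) abc
  no-infinite-CFL-subset : ∀ K → K ⊆L Compl L → Infinite K → ¬ IsCFL K
  no-infinite-CFL-subset K K⊆ ∞ K-cfl = ABC-unpumpable
    (Pumpable-mono (λ w → proj₁ (Compl-L≐ABC w) ∘ K⊆ w) (infinite-CFL-pumpable K-cfl ∞))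

L-simple : CFLSimple L
L-simple = L-infinite , isCFL-LangCFG _ , Compl-L-immune

proposition3p3 : (Σ ℕ λ k → Σ (Language (Fin k)) λ L → CFLSimple L)
    × (Σ ℕ λ k → Σ (Language (Fin k)) λ L →
    CFLSimple L × IsCFL2 (Compl L) × IsREGn (Compl L))
proposition3p3 = (3 , L , L-simple) , (3 , L , L-simple , complement-CFL2 , complement-REGn)
  where
  complement-CFL2 : IsCFL2 (Compl L)
  complement-CFL2 =
    L₁ , L₂ , isCFL-LangCFG _ , isCFL-LangCFG _ , ≐-trans Compl-L≐ABC ABC≐L₁∩L₂
  complement-REGn : IsREGn (Compl L)
  complement-REGn =
    thin⇒REGn aⁿbⁿcⁿ-ofLength aⁿbⁿcⁿ-ofLength-length (≐-trans Compl-L≐ABC ABC≐ofLength)
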